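{- Let $D=(V,A)$ be a finite directed graph, $\{S,T\}$ a partition of $V$ into nonempty sets with no arc from $T$ to $S$, and $w\in\mathbb{Z}_+^A$. Let $\xi\in\{0,1\}^{A[S,T]}$ be an optimal flow for (MSF) and let $(p,q)\in\mathbb{Z}^S\times\mathbb{Z}^T$ satisfy conditions (i)–(iii) together with $\xi$ and moreover $w(a)+p(u)-q(v)=0$ for every $a=uv\in A[S,T]$ with $\xi(a)=1$. Let $\tilde B_T$ be a minimum-$w'$-weight $r_T$-arborescence in $D_T$ with $R(\tilde B_T\cap A[T])=\mathrm{supp}^+(-\partial\xi|_T)$, and let $\rho^*$ be an integral optimal solution of (D$'$) with $\rho^*(v)\ge0$ for all $v\in T$. Let $\tilde B_S\subseteq A_S$ be an arc set of minimum $w''$-weight among those whose reversal is an $r_S$-arborescence in the reversal of $D_S$ and with $R^*(\tilde B_S\cap A[S])=\mathrm{supp}^+(\partial\xi|_S)$, and let $\pi^*$ be an integral optimal solution of (D$''$) with $\pi^*(u)\ge0$ for all $u\in S$. Let $F=\{a\in A[S,T]:\xi(a)=1\}$ and define $x^*=\chi_{F\cup(\tilde B_S\cap A[S])\cup(\tilde B_T\cap A[T])}\in\{0,1\}^A$, $y^*(S')=\pi^*(S')$ for $\emptyset\ne S'\subseteq S$, and $z^*(T')=\rho^*(T')$ for $\emptyset\ne T'\subseteq T$. Then $x^*$ is feasible for (P) and $(y^*,z^*)$ is feasible for (D).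
   Context: An arc $uv$ leaves $u$ and enters $v$. In a digraph, $\delta^+X$ ($\delta^-X$) is the set of arcs leaving (entering) vertex set $X$, $\delta^\pm u=\delta^\pm\{u\}$. $A[X]$: arcs of $A$ with both ends in $X$; $A[S,T]=\{uv\in A:u\in S,v\in T\}$; $D[S]=(S,A[S])$, $D[T]=(T,A[T])$. $\chi_Y$ is the characteristic vector of $Y$. A branching is an arc set with no directed cycle in which every vertex is entered by at most one arc; an $r$-arborescence is a branching in which every vertex other than $r$ is entered by an arc. For a branching $B$ in $D[T]$, $R(B)$ = vertices of $T$ entered by no arc of $B$; a cobranching is an arc set whose reversal is a branching, and for a cobranching $B$ in $D[S]$, $R^*(B)$ = vertices of $S$ left by no arc of $B$. $\mathrm{supp}^+(\eta)=\{u:\eta(u)>0\}$. $g_T(\eta)=\min\{w(B):B\text{ branching in }D[T],R(B)=\mathrm{supp}^+(\eta)\}$ for $\eta\in\mathbb{Z}_+^T$ when such exists, else $+\infty$; $g_S$ analogous with cobranchings in $D[S]$ and $R^*$. For $\xi\in\{0,1\}^{A[S,T]}$, $\partial\xi(v)=|\{a\in\delta^+v:\xi(a)=1\}|-|\{a\in\delta^-v:\xi(a)=1\}|$. Feasible: $g_S(\partial\xi|_S),g_T(-\partial\xi|_T)<\infty$. (MSF): minimize $\sum_{a\in A[S,T]}w(a)\xi(a)+g_S(\partial\xi|_S)+g_T(-\partial\xi|_T)$; optimal flow = feasible minimizer. $g_S[-p](\eta)=g_S(\eta)-\sum_up(u)\eta(u)$, $g_T[+q](\zeta)=g_T(\zeta)+\sum_vq(v)\zeta(v)$.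 Conditions: (i) for $a=uv\in A[S,T]$, $\xi(a)=1\Rightarrow w(a)+p(u)-q(v)\le0$, $\xi(a)=0\Rightarrow w(a)+p(u)-q(v)\ge0$; (ii) $\partial\xi|_S\in\arg\min g_S[-p]$; (iii) $-\partial\xi|_T\in\arg\min g_T[+q]$. $D_T=(V_T,A_T)$: $V_T=\{r_T\}\cup T$, $A_T=\{r_Tv:v\in T\}\cup A[T]$, $w'(r_Tv)=q(v)$, $w'(uv)=w(uv)$ for $uv\in A[T]$. (D$'$): maximize $\sum_{v\in T}\rho(v)+\sum_{T'\subseteq T,|T'|\ge2}\rho(T')$ subject to $\rho(v)+\sum_{T'\subseteq T,|T'|\ge2,\ a\in\delta^-T'}\rho(T')\le w'(a)$ for every $a=uv\in A_T$ ($\delta^-$ taken in $D_T$), and $\rho(T')\ge0$ for $|T'|\ge2$ (here $\rho(v)$ means $\rho(\{v\})$). $D_S=(V_S,A_S)$: $V_S=\{r_S\}\cup S$, $A_S=\{ur_S:u\in S\}\cup A[S]$, $w''(ur_S)=-p(u)$, $w''(uv)=w(uv)$ for $uv\in A[S]$. (D$''$): maximize $\sum_{u\in S}\pi(u)+\sum_{S'\subseteq S,|S'|\ge2}\pi(S')$ subject to $\pi(u)+\sum_{S'\subseteq S,|S'|\ge2,\ a\in\delta^+S'}\pi(S')\le w''(a)$ for every $a=uv\in A_S$ ($\delta^+$ in $D_S$), and $\pi(S')\ge0$ for $|S'|\ge2$. (P): minimize $\sum_{a\in A}w(a)x(a)$ s.t. $\sum_{a\in\delta^+S'}x(a)\ge1$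 ($\emptyset\ne S'\subseteq S$), $\sum_{a\in\delta^-T'}x(a)\ge1$ ($\emptyset\ne T'\subseteq T$), $x\ge0$ ($\delta^\pm$ in $D$). (D): maximize $\sum_{\emptyset\ne S'\subseteq S}y(S')+\sum_{\emptyset\ne T'\subseteq T}z(T')$ s.t. $\sum_{S'\subseteq S,a\in\delta^+S'}y(S')+\sum_{T'\subseteq T,a\in\delta^-T'}z(T')\le w(a)$ ($a\in A$), $y,z\ge0$. -}

module Defs where

open import Data.Bool using (Bool; true; false; not; _∧_; _∨_; if_then_else_)
open import Data.Nat as ℕ using (ℕ; zero; suc)
open import Data.Integer as ℤ using (ℤ; +_)
open import Data.Rational as ℚ using (ℚ; 0ℚ; 1ℚ)
open import Data.Fin using (Fin)
open import Data.Fin.Properties using (_≟_)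
open import Data.Fin.Subset using (Subset; _∈_; _⊆_; ⁅_⁆; ∣_∣; Nonempty)
open import Data.Fin.Subset.Properties using (_∈?_; _⊆?_; nonempty?)
open import Data.Vec using (Vec; []; _∷_; tabulate)
open import Data.List as List using (List; []; _∷_; map; _++_; foldr; allFin)
open import Data.Maybe using (Maybe; just; nothing)
open import Data.Sum using (_⊎_; inj₁; inj₂)
open import Data.Product using (Σ; ∃; _×_; _,_)
open import Data.Unit using (⊤)
open import Data.Empty using (⊥)
open import Function.Bundles using (_⇔_)
open import Relation.Nullary using (¬_; Dec; yes; no; does)
open import Relation.Nullary.Decidable using (_×-dec_; ¬?)
open import Relation.Unary using (Decidable)
open import Relation.Binary.PropositionalEquality using (_≡_; _≢_)

module _ {V A : Set} (tl hd : A → V) where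

  data Walk⁺ (B : A → Bool) : V → V → Set where
    one  : ∀ a → B a ≡ true → Walk⁺ B (tl a) (hd a)
    cons : ∀ a {v} → B a ≡ true → Walk⁺ B (hd a) v → Walk⁺ B (tl a) v

  AtMostOneIn : (A → Bool) → Set
  AtMostOneIn B = ∀ a b → B a ≡ true → B b ≡ true → hd a ≡ hd b → a ≡ b

  Acyclic : (A → Bool) → Set
  Acyclic B = ∀ v → ¬ Walk⁺ B v v

  IsBranching : (A → Bool) → Set
  IsBranching B = AtMostOneIn B × Acyclic B

  Entered : (A → Bool) → V → Set
  Entered B v = ∃ λ a → B a ≡ true × hd a ≡ v

  IsArborescence : (V → Set) → V → (A → Bool) → Set
  IsArborescence Vtx r B = IsBranching B × (∀ v → Vtx v → v ≢ r → Entered B v)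

Σℤ : {X : Set} → List X → (X → ℤ) → ℤ
Σℤ xs f = foldr (λ x s → f x ℤ.+ s) (+ 0) xs

Σℚ : {X : Set} → List X → (X → ℚ) → ℚ
Σℚ xs f = foldr (λ x s → f x ℚ.+ s) 0ℚ xs

Σℕ : {X : Set} → List X → (X → ℕ) → ℕ
Σℕ xs f = foldr (λ x s → f x ℕ.+ s) 0 xs

Σℚ[_∣_] : {X : Set} {P : X → Set} → List X → Decidable P → (X → ℚ) → ℚ
Σℚ[ xs ∣ P? ] f = Σℚ xs (λ x → if does (P? x) then f x else 0ℚ)

allSubsets : (n : ℕ) → List (Subset n)
allSubsets zero = [] ∷ []
allSubsets (suc n) = map (true ∷_) (allSubsets n) ++ map (false ∷_) (allSubsets n)

ℤ→ℚ : ℤ → ℚ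
ℤ→ℚ k = k ℚ./ 1

-- The setting: D = (Fin n, Fin m) with tail/head maps, S = {v : inS v = true},
-- T = {v : inS v = false}, weights w.

module Setup (n m : ℕ) (tl hd : Fin m → Fin n) (inS : Fin n → Bool) (w : Fin m → ℕ) where

  InS InT : Fin n → Set
  InS v = inS v ≡ true
  InT v = inS v ≡ false

  Sset Tset : Subset n
  Sset = tabulate inS
  Tset = tabulate (λ v → not (inS v))

  inAS inAT inAST : Fin m → Bool
  inAS a = inS (tl a) ∧ inS (hd a)
  inAT a = not (inS (tl a)) ∧ not (inS (hd a))
  inAST a = inS (tl a) ∧ not (inS (hd a))

  arcs : List (Fin m)
  arcs = allFin m

  verts : List (Fin n)
  verts = allFin n

  count : (Fin m → Bool) → ℕ
  count P = Σℕ arcs (λ a → if P a then 1 else 0)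

  wt : (Fin m → Bool) → ℕ
  wt B = Σℕ arcs (λ a → if B a then w a else 0)

  -- ∂ξ, only arcs of A[S,T] count (ξ ∈ {0,1}^{A[S,T]})
  ∂ : (Fin m → Bool) → Fin n → ℤ
  ∂ ξ v = + count (λ a → ξ a ∧ inAST a ∧ does (tl a ≟ v))
          ℤ.- + count (λ a → ξ a ∧ inAST a ∧ does (hd a ≟ v))

  ΣS ΣT : (Fin n → ℤ) → ℤ
  ΣS f = Σℤ verts (λ u → if inS u then f u else + 0)
  ΣT f = Σℤ verts (λ v → if inS v then + 0 else f v)

  BranchingT : (Fin m → Bool) → Set
  BranchingT B = (∀ a → B a ≡ true → inAT a ≡ true) × IsBranching tl hd B

  CobranchingS : (Fin m → Bool) → Set
  CobranchingS B = (∀ a → B a ≡ true → inAS a ≡ true) × IsBranching hd tl B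

  -- R(B) = supp⁺(η)   (both sides are subsets of T)
  RootsT : (Fin m → Bool) → (Fin n → ℤ) → Set
  RootsT B η = ∀ v → InT v → ((¬ Entered tl hd B v) ⇔ (+ 0 ℤ.< η v))

  -- R*(B) = supp⁺(η)  (both sides are subsets of S); "left by no arc" =
  -- "entered by no arc of the reversal"
  RootsS : (Fin m → Bool) → (Fin n → ℤ) → Set
  RootsS B η = ∀ u → InS u → ((¬ Entered hd tl B u) ⇔ (+ 0 ℤ.< η u))

  -- g_T(η) = c  (in particular g_T(η) < ∞)
  GT : (Fin n → ℤ) → ℤ → Set
  GT η c = (∃ λ B → BranchingT B × RootsT B η × + wt B ≡ c)
         × (∀ B → BranchingT B → RootsT B η → c ℤ.≤ + wt B)

  -- g_S(η) = c  (in particular g_S(η) < ∞)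
  GS : (Fin n → ℤ) → ℤ → Set
  GS η c = (∃ λ B → CobranchingS B × RootsS B η × + wt B ≡ c)
         × (∀ B → CobranchingS B → RootsS B η → c ℤ.≤ + wt B)

  NonnegS NonnegT : (Fin n → ℤ) → Set
  NonnegS η = ∀ u → InS u → + 0 ℤ.≤ η u
  NonnegT η = ∀ v → InT v → + 0 ℤ.≤ η v

  neg∂ : (Fin m → Bool) → Fin n → ℤ
  neg∂ ξ v = ℤ.- ∂ ξ v

  flowCost : (Fin m → Bool) → ℕ
  flowCost ξ = wt (λ a → ξ a ∧ inAST a)

  OptimalFlow : (Fin m → Bool) → Set
  OptimalFlow ξ = Σ ℤ λ cS → Σ ℤ λ cT → GS (∂ ξ) cS × GT (neg∂ ξ) cT ×
    (∀ ξ' cS' cT' → GS (∂ ξ') cS' → GT (neg∂ ξ') cT' →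
       + flowCost ξ ℤ.+ cS ℤ.+ cT ℤ.≤ + flowCost ξ' ℤ.+ cS' ℤ.+ cT')

  CondI : (Fin m → Bool) → (p q : Fin n → ℤ) → Set
  CondI ξ p q = ∀ a → inAST a ≡ true →
      (ξ a ≡ true → + w a ℤ.+ p (tl a) ℤ.- q (hd a) ℤ.≤ + 0)
    × (ξ a ≡ false → + 0 ℤ.≤ + w a ℤ.+ p (tl a) ℤ.- q (hd a))

  Tight : (Fin m → Bool) → (p q : Fin n → ℤ) → Set
  Tight ξ p q = ∀ a → inAST a ≡ true → ξ a ≡ true →
    + w a ℤ.+ p (tl a) ℤ.- q (hd a) ≡ + 0

  -- condition (ii): ∂ξ|_S ∈ argmin g_S[-p] over ℤ_+^S
  CondII : (Fin m → Bool) → (p : Fin n → ℤ) → Set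
  CondII ξ p = Σ ℤ λ c → GS (∂ ξ) c ×
    (∀ η → NonnegS η → ∀ c' → GS η c' →
       c ℤ.- ΣS (λ u → p u ℤ.* ∂ ξ u) ℤ.≤ c' ℤ.- ΣS (λ u → p u ℤ.* η u))

  -- condition (iii): -∂ξ|_T ∈ argmin g_T[+q] over ℤ_+^T
  CondIII : (Fin m → Bool) → (q : Fin n → ℤ) → Set
  CondIII ξ q = Σ ℤ λ c → GT (neg∂ ξ) c ×
    (∀ ζ → NonnegT ζ → ∀ c' → GT ζ c' →
       c ℤ.+ ΣT (λ v → q v ℤ.* neg∂ ξ v) ℤ.≤ c' ℤ.+ ΣT (λ v → q v ℤ.* ζ v))

  -- Auxiliary digraphs.  Both have vertex type Maybe (Fin n) (nothing = the
  -- new root) and arc type Fin n ⊎ Fin m (inj₁ v = arc between the root and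
  -- v, inj₂ a = original arc a).

  ArcAux : Set
  ArcAux = Fin n ⊎ Fin m

  auxArcs : List ArcAux
  auxArcs = map inj₁ verts ++ map inj₂ arcs

  _∈M_ : Maybe (Fin n) → Subset n → Set
  nothing ∈M X = ⊥
  just v  ∈M X = v ∈ X

  _∈M?_ : (x : Maybe (Fin n)) (X : Subset n) → Dec (x ∈M X)
  nothing ∈M? X = no (λ ())
  just v  ∈M? X = v ∈? X

  tlT hdT : ArcAux → Maybe (Fin n)
  tlT (inj₁ v) = nothing
  tlT (inj₂ a) = just (tl a)
  hdT (inj₁ v) = just v
  hdT (inj₂ a) = just (hd a)

  headT : ArcAux → Fin n
  headT (inj₁ v) = v
  headT (inj₂ a) = hd a

  ArcT : ArcAux → Set
  ArcT (inj₁ v) = InT v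
  ArcT (inj₂ a) = inAT a ≡ true

  VtxT : Maybe (Fin n) → Set
  VtxT nothing  = ⊤
  VtxT (just v) = InT v

  w' : (q : Fin n → ℤ) → ArcAux → ℤ
  w' q (inj₁ v) = q v
  w' q (inj₂ a) = + w a

  wtT : (q : Fin n → ℤ) → (ArcAux → Bool) → ℤ
  wtT q B = Σℤ auxArcs (λ x → if B x then w' q x else + 0)

  ArbT : (ArcAux → Bool) → Set
  ArbT B = (∀ x → B x ≡ true → ArcT x) × IsArborescence tlT hdT VtxT nothing B

  ∩AT : (ArcAux → Bool) → Fin m → Bool
  ∩AT B a = B (inj₂ a) ∧ inAT a

  MinArbT : (q : Fin n → ℤ) → (Fin n → ℤ) → (ArcAux → Bool) → Set
  MinArbT q η B = ArbT B × RootsT (∩AT B) η ×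
    (∀ B' → ArbT B' → RootsT (∩AT B') η → wtT q B ℤ.≤ wtT q B')

  tlS hdS : ArcAux → Maybe (Fin n)
  tlS (inj₁ u) = just u
  tlS (inj₂ a) = just (tl a)
  hdS (inj₁ u) = nothing
  hdS (inj₂ a) = just (hd a)

  tailS : ArcAux → Fin n
  tailS (inj₁ u) = u
  tailS (inj₂ a) = tl a

  ArcS : ArcAux → Set
  ArcS (inj₁ u) = InS u
  ArcS (inj₂ a) = inAS a ≡ true

  VtxS : Maybe (Fin n) → Set
  VtxS nothing  = ⊤
  VtxS (just u) = InS u

  w'' : (p : Fin n → ℤ) → ArcAux → ℤ
  w'' p (inj₁ u) = ℤ.- p u
  w'' p (inj₂ a) = + w a

  wtS : (p : Fin n → ℤ) → (ArcAux → Bool) → ℤ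
  wtS p B = Σℤ auxArcs (λ x → if B x then w'' p x else + 0)

  ArbS : (ArcAux → Bool) → Set
  ArbS B = (∀ x → B x ≡ true → ArcS x) × IsArborescence hdS tlS VtxS nothing B

  ∩AS : (ArcAux → Bool) → Fin m → Bool
  ∩AS B a = B (inj₂ a) ∧ inAS a

  MinArbS : (p : Fin n → ℤ) → (Fin n → ℤ) → (ArcAux → Bool) → Set
  MinArbS p η B = ArbS B × RootsS (∩AS B) η ×
    (∀ B' → ArbS B' → RootsS (∩AS B') η → wtS p B ℤ.≤ wtS p B')

  -- (D') : variables ρ(T') for T' ⊆ T; ρ(v) := ρ({v}).

  subsets : List (Subset n)
  subsets = allSubsets n

  BigT : Subset n → Set
  BigT X = X ⊆ Tset × 2 ℕ.≤ ∣ X ∣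

  BigT? : Decidable BigT
  BigT? X = (X ⊆? Tset) ×-dec (2 ℕ.≤? ∣ X ∣)

  EntersT : ArcAux → Subset n → Set
  EntersT x X = hdT x ∈M X × ¬ (tlT x ∈M X)

  EntersT? : (x : ArcAux) → Decidable (EntersT x)
  EntersT? x X = (hdT x ∈M? X) ×-dec ¬? (tlT x ∈M? X)

  FeasD' : (q : Fin n → ℤ) → (Subset n → ℚ) → Set
  FeasD' q ρ =
      (∀ x → ArcT x →
         ρ ⁅ headT x ⁆ ℚ.+ Σℚ[ subsets ∣ (λ X → BigT? X ×-dec EntersT? x X) ] ρ
           ℚ.≤ ℤ→ℚ (w' q x))
    × (∀ X → BigT X → 0ℚ ℚ.≤ ρ X)

  ObjD' : (Subset n → ℚ) → ℚ
  ObjD' ρ = Σℚ verts (λ v → if inS v then 0ℚ else ρ ⁅ v ⁆)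
            ℚ.+ Σℚ[ subsets ∣ BigT? ] ρ

  OptD' : (q : Fin n → ℤ) → (Subset n → ℚ) → Set
  OptD' q ρ = FeasD' q ρ × (∀ ρ' → FeasD' q ρ' → ObjD' ρ' ℚ.≤ ObjD' ρ)

  -- (D'') : variables π(S') for S' ⊆ S; π(u) := π({u}).

  BigS : Subset n → Set
  BigS X = X ⊆ Sset × 2 ℕ.≤ ∣ X ∣

  BigS? : Decidable BigS
  BigS? X = (X ⊆? Sset) ×-dec (2 ℕ.≤? ∣ X ∣)

  LeavesS : ArcAux → Subset n → Set
  LeavesS x X = tlS x ∈M X × ¬ (hdS x ∈M X)

  LeavesS? : (x : ArcAux) → Decidable (LeavesS x)
  LeavesS? x X = (tlS x ∈M? X) ×-dec ¬? (hdS x ∈M? X)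

  FeasD'' : (p : Fin n → ℤ) → (Subset n → ℚ) → Set
  FeasD'' p π =
      (∀ x → ArcS x →
         π ⁅ tailS x ⁆ ℚ.+ Σℚ[ subsets ∣ (λ X → BigS? X ×-dec LeavesS? x X) ] π
           ℚ.≤ ℤ→ℚ (w'' p x))
    × (∀ X → BigS X → 0ℚ ℚ.≤ π X)

  ObjD'' : (Subset n → ℚ) → ℚ
  ObjD'' π = Σℚ verts (λ u → if inS u then π ⁅ u ⁆ else 0ℚ)
             ℚ.+ Σℚ[ subsets ∣ BigS? ] π

  OptD'' : (p : Fin n → ℤ) → (Subset n → ℚ) → Set
  OptD'' p π = FeasD'' p π × (∀ π' → FeasD'' p π' → ObjD'' π' ℚ.≤ ObjD'' π)

  IntegralT IntegralS : (Subset n → ℚ) → Set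
  IntegralT ρ = ∀ X → X ⊆ Tset → Nonempty X → ∃ λ k → ρ X ≡ ℤ→ℚ k
  IntegralS π = ∀ X → X ⊆ Sset → Nonempty X → ∃ λ k → π X ≡ ℤ→ℚ k

  NESub : Subset n → Subset n → Set
  NESub U X = Nonempty X × X ⊆ U

  NESub? : (U : Subset n) → Decidable (NESub U)
  NESub? U X = nonempty? X ×-dec (X ⊆? U)

  Leaves Enters : Fin m → Subset n → Set
  Leaves a X = tl a ∈ X × ¬ (hd a ∈ X)
  Enters a X = hd a ∈ X × ¬ (tl a ∈ X)

  Leaves? : (a : Fin m) → Decidable (Leaves a)
  Leaves? a X = (tl a ∈? X) ×-dec ¬? (hd a ∈? X)
  Enters? : (a : Fin m) → Decidable (Enters a)
  Enters? a X = (hd a ∈? X) ×-dec ¬? (tl a ∈? X)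

  FeasP : (Fin m → ℚ) → Set
  FeasP x =
      (∀ X → NESub Sset X → 1ℚ ℚ.≤ Σℚ[ arcs ∣ (λ a → Leaves? a X) ] x)
    × (∀ X → NESub Tset X → 1ℚ ℚ.≤ Σℚ[ arcs ∣ (λ a → Enters? a X) ] x)
    × (∀ a → 0ℚ ℚ.≤ x a)

  FeasD : (y z : Subset n → ℚ) → Set
  FeasD y z =
      (∀ a → Σℚ[ subsets ∣ (λ X → NESub? Sset X ×-dec Leaves? a X) ] y
             ℚ.+ Σℚ[ subsets ∣ (λ X → NESub? Tset X ×-dec Enters? a X) ] z
             ℚ.≤ ℤ→ℚ (+ w a))
    × (∀ X → NESub Sset X → 0ℚ ℚ.≤ y X)
    × (∀ X → NESub Tset X → 0ℚ ℚ.≤ z X)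

  xstar : (ξ : Fin m → Bool) (BS BT : ArcAux → Bool) → Fin m → ℚ
  xstar ξ BS BT a =
    if (ξ a ∧ inAST a) ∨ ∩AS BS a ∨ ∩AT BT a then 1ℚ else 0ℚ

  ystar zstar : (Subset n → ℚ) → Subset n → ℚ
  ystar π X = π X
  zstar ρ X = ρ X

module Submission where

-- Primal side.  Take ∅ ≠ X ⊆ S and suppose no arc of x* leaves X.  Every
-- u ∈ X is left by an arc of B̃_S.  An arc u r_S is the only B̃_S-arc leaving
-- u, so u ∈ R*(B̃_S ∩ A[S]) = supp⁺(∂ξ) and a flow arc of F leaves X; an arc
-- uv ∈ A[S] with v ∉ X would lie in x*.  Hence every u ∈ X is left by an arc of
-- B̃_S ending in X, and by pigeonhole the reversal of B̃_S has a cycle, which is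
-- absurd.  Sets X ⊆ T are symmetric.
--
-- Dual side.  For every arc a the y-sum (sets S' left by a) is bounded by
-- splitting off the singleton {tail a}: what remains are sets of size ≥ 2, all
-- left by a suitable arc of D_S, so the (D'') constraint of that arc applies;
-- likewise for the z-sum and (D').  Arcs of A[S] and A[T] are then bounded by
-- w(a) directly, and arcs uv ∈ A[S,T] by -p(u) + q(v) ≤ w(a), the
-- nonnegativity of the reduced cost coming from condition (i) and tightness.

open import Defs
open import Data.Bool using (Bool; true; false; not; _∧_; _∨_; if_then_else_)
import Data.Bool.Properties as BoolP
open import Data.Nat as ℕ using (ℕ; zero; suc; z≤n; s≤s)
import Data.Nat.Properties as ℕP
open import Data.Integer as ℤ using (ℤ; +_; +≤+; +<+)
import Data.Integer.Properties as ℤP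
open import Data.Integer.Solver using (module +-*-Solver)
open import Data.Rational as ℚ using (ℚ; 0ℚ; 1ℚ; _≤_; _+_)
import Data.Rational.Properties as ℚP
import Data.Rational.Unnormalised as ℚᵘ
import Data.Rational.Unnormalised.Properties as ℚᵘP
open import Data.Fin as F using (Fin; toℕ)
import Data.Fin.Properties as FinP
open import Data.Fin.Subset using (Subset; _∈_; _⊆_; ⁅_⁆; ∣_∣; Nonempty) renaming (⊥ to ∅)
open import Data.Fin.Subset.Properties
  using (_∈?_; Empty-unique; x∈⁅y⁆⇒x≡y; ∣⁅x⁆∣≡1; p⊆q⇒∣p∣≤∣q∣)
open import Data.Vec using ([]; _∷_; here; there)
import Data.Vec.Properties as VecP
open import Data.List using (List; []; _∷_; map; _++_)
open import Data.List.Membership.Propositional renaming (_∈_ to _∈ₗ_)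
open import Data.List.Membership.Propositional.Properties using (∈-allFin)
import Data.List.Relation.Unary.Any as Any
open import Data.Maybe using (just)
open import Data.Sum using (_⊎_; inj₁; inj₂)
open import Data.Product using (Σ; ∃; ∃₂; _×_; _,_; proj₁; proj₂)
open import Data.Empty using (⊥-elim)
open import Function.Bundles using (Equivalence)
open import Relation.Nullary using (¬_; Dec; yes; no; does)
open import Relation.Nullary.Decidable using (dec-true; dec-false; _×-dec_)
open import Relation.Unary using (Decidable)
open import Relation.Binary.Definitions using (DecidableEquality)
open import Relation.Binary.PropositionalEquality
open import Algebra.Bundles using (CommutativeMonoid)
open import Algebra.Properties.CommutativeSemigroup
  (CommutativeMonoid.commutativeSemigroup ℚP.+-0-commutativeMonoid) using (interchange)

does-true⇒ : {P : Set} (P? : Dec P) → does P? ≡ true → P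
does-true⇒ (yes p) _ = p

∧₃-split : ∀ x y z → x ∧ y ∧ z ≡ true → x ∧ y ≡ true × z ≡ true
∧₃-split true  true  true  refl = refl , refl
∧₃-split false _     _     ()
∧₃-split true  false _     ()
∧₃-split true  true  false ()

ℤ→ℚ-toℚᵘ : (k : ℤ) → ℚ.toℚᵘ (ℤ→ℚ k) ℚᵘ.≃ ℚᵘ.mkℚᵘ k 0
ℤ→ℚ-toℚᵘ k = ℚP.toℚᵘ-fromℚᵘ (ℚᵘ.mkℚᵘ k 0)

ℤ→ℚ-mono-≤ : {i j : ℤ} → i ℤ.≤ j → ℤ→ℚ i ≤ ℤ→ℚ j
ℤ→ℚ-mono-≤ {i} {j} i≤j = ℚP.toℚᵘ-cancel-≤
  (ℚᵘP.≤-respˡ-≃ (ℚᵘP.≃-sym (ℤ→ℚ-toℚᵘ i)) (ℚᵘP.≤-respʳ-≃ (ℚᵘP.≃-sym (ℤ→ℚ-toℚᵘ j))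
    (ℚᵘ.*≤* (subst₂ ℤ._≤_ (sym (ℤP.*-identityʳ i)) (sym (ℤP.*-identityʳ j)) i≤j))))

ℤ→ℚ-+ : (i j : ℤ) → ℤ→ℚ i + ℤ→ℚ j ≡ ℤ→ℚ (i ℤ.+ j)
ℤ→ℚ-+ i j = ℚP.toℚᵘ-injective (begin
  ℚ.toℚᵘ (ℤ→ℚ i + ℤ→ℚ j)                   ≈⟨ ℚP.toℚᵘ-homo-+ (ℤ→ℚ i) (ℤ→ℚ j) ⟩
  ℚ.toℚᵘ (ℤ→ℚ i) ℚᵘ.+ ℚ.toℚᵘ (ℤ→ℚ j)       ≈⟨ ℚᵘP.+-cong (ℤ→ℚ-toℚᵘ i) (ℤ→ℚ-toℚᵘ j) ⟩
  ℚᵘ.mkℚᵘ i 0 ℚᵘ.+ ℚᵘ.mkℚᵘ j 0             ≈⟨ ℚᵘ.*≡* (cong (ℤ._* + 1) sum-num) ⟩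
  ℚᵘ.mkℚᵘ (i ℤ.+ j) 0                        ≈⟨ ℚᵘP.≃-sym (ℤ→ℚ-toℚᵘ (i ℤ.+ j)) ⟩
  ℚ.toℚᵘ (ℤ→ℚ (i ℤ.+ j))                     ∎)
  where
  open ℚᵘP.≃-Reasoning
  sum-num : i ℤ.* + 1 ℤ.+ j ℤ.* + 1 ≡ i ℤ.+ j
  sum-num = cong₂ ℤ._+_ (ℤP.*-identityʳ i) (ℤP.*-identityʳ j)

module _ {X : Set} where

  Σℚ-mono : (xs : List X) {f g : X → ℚ} → (∀ x → f x ≤ g x) → Σℚ xs f ≤ Σℚ xs g
  Σℚ-mono []       f≤g = ℚP.≤-refl
  Σℚ-mono (x ∷ xs) f≤g = ℚP.+-mono-≤ (f≤g x) (Σℚ-mono xs f≤g)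

  Σℚ-nonneg : (xs : List X) {f : X → ℚ} → (∀ x → 0ℚ ≤ f x) → 0ℚ ≤ Σℚ xs f
  Σℚ-nonneg []       f≥0 = ℚP.≤-refl
  Σℚ-nonneg (x ∷ xs) f≥0 = ℚP.+-mono-≤ (f≥0 x) (Σℚ-nonneg xs f≥0)

  Σℚ-zero : (xs : List X) {f : X → ℚ} → (∀ x → f x ≡ 0ℚ) → Σℚ xs f ≡ 0ℚ
  Σℚ-zero []       f≡0 = refl
  Σℚ-zero (x ∷ xs) f≡0 = cong₂ _+_ (f≡0 x) (Σℚ-zero xs f≡0)

  Σℚ-+ : (xs : List X) (f g : X → ℚ) → Σℚ xs (λ x → f x + g x) ≡ Σℚ xs f + Σℚ xs g
  Σℚ-+ []       f g = refl
  Σℚ-+ (x ∷ xs) f g =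
    trans (cong (_+_ (f x + g x)) (Σℚ-+ xs f g)) (interchange (f x) (g x) (Σℚ xs f) (Σℚ xs g))

  Σℚ-++ : (xs ys : List X) (f : X → ℚ) → Σℚ (xs ++ ys) f ≡ Σℚ xs f + Σℚ ys f
  Σℚ-++ []       ys f = sym (ℚP.+-identityˡ (Σℚ ys f))
  Σℚ-++ (x ∷ xs) ys f = trans (cong (_+_ (f x)) (Σℚ-++ xs ys f)) (sym (ℚP.+-assoc (f x) _ _))

  Σℚ-elem : (xs : List X) {f : X → ℚ} → (∀ x → 0ℚ ≤ f x) → ∀ {y} → y ∈ₗ xs → f y ≤ Σℚ xs f
  Σℚ-elem (x ∷ xs) {f} f≥0 (Any.here refl) =
    subst (_≤ Σℚ (x ∷ xs) f) (ℚP.+-identityʳ (f x)) (ℚP.+-monoʳ-≤ (f x) (Σℚ-nonneg xs f≥0))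
  Σℚ-elem (x ∷ xs) {f} f≥0 {y} (Any.there y∈xs) =
    subst (_≤ Σℚ (x ∷ xs) f) (ℚP.+-identityˡ (f y)) (ℚP.+-mono-≤ (f≥0 x) (Σℚ-elem xs f≥0 y∈xs))

Σℚ-map : {X Y : Set} (g : X → Y) (xs : List X) (f : Y → ℚ) → Σℚ (map g xs) f ≡ Σℚ xs (λ x → f (g x))
Σℚ-map g []       f = refl
Σℚ-map g (x ∷ xs) f = cong (_+_ (f (g x))) (Σℚ-map g xs f)

module _ {X : Set} {P : X → Set} (P? : Decidable P) where

  restrict : (X → ℚ) → X → ℚ
  restrict f x = if does (P? x) then f x else 0ℚ

  restrict-nonneg : {f : X → ℚ} → (∀ x → P x → 0ℚ ≤ f x) → ∀ x → 0ℚ ≤ restrict f x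
  restrict-nonneg f≥0 x with P? x
  ... | yes px = f≥0 x px
  ... | no _   = ℚP.≤-refl

  Σℚ[]-elem : (xs : List X) {f : X → ℚ} → (∀ x → P x → 0ℚ ≤ f x) →
    ∀ {y} → y ∈ₗ xs → P y → f y ≤ Σℚ[ xs ∣ P? ] f
  Σℚ[]-elem xs {f} f≥0 {y} y∈xs py =
    subst (_≤ Σℚ[ xs ∣ P? ] f) (cong (λ b → if b then f y else 0ℚ) (dec-true (P? y) py))
      (Σℚ-elem xs (restrict-nonneg f≥0) y∈xs)

  Σℚ[]-empty : (xs : List X) (f : X → ℚ) → (∀ x → ¬ P x) → Σℚ[ xs ∣ P? ] f ≡ 0ℚ
  Σℚ[]-empty xs f ¬P = Σℚ-zero xs (λ x → cong (λ b → if b then f x else 0ℚ) (dec-false (P? x) (¬P x)))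

_≟ˢ_ : {n : ℕ} → DecidableEquality (Subset n)
_≟ˢ_ = VecP.≡-dec BoolP._≟_

-- Every subset occurs exactly once in allSubsets n, so summing f over the
-- subsets equal to Y picks out f(Y).
Σ-allSubsets-≡ : (n : ℕ) (f : Subset n → ℚ) (Y : Subset n) → Σℚ[ allSubsets n ∣ _≟ˢ Y ] f ≡ f Y
Σ-allSubsets-≡ zero    f [] = ℚP.+-identityʳ (f [])
Σ-allSubsets-≡ (suc n) f (y ∷ Y) = begin
  Σℚ (map (true ∷_) L ++ map (false ∷_) L) g           ≡⟨ Σℚ-++ (map (true ∷_) L) _ g ⟩
  Σℚ (map (true ∷_) L) g + Σℚ (map (false ∷_) L) g     ≡⟨ cong₂ _+_ (Σℚ-map (true ∷_) L g)
                                                                      (Σℚ-map (false ∷_) L g) ⟩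
  Σℚ L (λ X → g (true ∷ X)) + Σℚ L (λ X → g (false ∷ X)) ≡⟨ halves y ⟩
  f (y ∷ Y)                                              ∎
  where
  open ≡-Reasoning
  L = allSubsets n
  g = restrict (_≟ˢ (y ∷ Y)) f
  halves : ∀ y → Σℚ L (λ X → restrict (_≟ˢ (y ∷ Y)) f (true ∷ X))
               + Σℚ L (λ X → restrict (_≟ˢ (y ∷ Y)) f (false ∷ X)) ≡ f (y ∷ Y)
  halves true  = trans (cong₂ _+_ (Σ-allSubsets-≡ n (λ X → f (true ∷ X)) Y)
                                  (Σℚ-zero L (λ _ → refl)))
                       (ℚP.+-identityʳ (f (true ∷ Y)))
  halves false = trans (cong₂ _+_ (Σℚ-zero L (λ _ → refl))
                                  (Σ-allSubsets-≡ n (λ X → f (false ∷ X)) Y))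
                       (ℚP.+-identityˡ (f (false ∷ Y)))

Σ-split-singleton : {n : ℕ} (f : Subset n → ℚ) (u : Fin n) {P R : Subset n → Set}
  (P? : Decidable P) (R? : Decidable R) →
  0ℚ ≤ f ⁅ u ⁆ → (∀ X → R X → 0ℚ ≤ f X) → (∀ X → P X → R X ⊎ X ≡ ⁅ u ⁆) →
  Σℚ[ allSubsets n ∣ P? ] f ≤ f ⁅ u ⁆ + Σℚ[ allSubsets n ∣ R? ] f
Σ-split-singleton {n} f u P? R? fu≥0 fR≥0 P⇒R∨u = begin
  Σℚ L (restrict P? f)                              ≤⟨ Σℚ-mono L pointwise ⟩
  Σℚ L (λ X → single X + restrict R? f X)           ≡⟨ Σℚ-+ L single (restrict R? f) ⟩
  Σℚ L single + Σℚ L (restrict R? f)                ≡⟨ cong (_+ Σℚ L (restrict R? f))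
                                                         (Σ-allSubsets-≡ n f ⁅ u ⁆) ⟩
  f ⁅ u ⁆ + Σℚ L (restrict R? f)                    ∎
  where
  open ℚP.≤-Reasoning
  L = allSubsets n
  single = restrict (_≟ˢ ⁅ u ⁆) f
  single≥0 : ∀ X → 0ℚ ≤ single X
  single≥0 = restrict-nonneg (_≟ˢ ⁅ u ⁆) (λ X X≡u → subst (λ Y → 0ℚ ≤ f Y) (sym X≡u) fu≥0)
  pointwise : ∀ X → restrict P? f X ≤ single X + restrict R? f X
  pointwise X with P? X
  ... | no _ = ℚP.+-mono-≤ (single≥0 X) (restrict-nonneg R? fR≥0 X)
  ... | yes PX with R? X | P⇒R∨u X PX
  ...   | yes _ | _      = subst (_≤ single X + f X) (ℚP.+-identityˡ (f X))
                                 (ℚP.+-monoˡ-≤ (f X) (single≥0 X))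
  ...   | no ¬RX | inj₁ RX = ⊥-elim (¬RX RX)
  ...   | no _   | inj₂ refl with ⁅ u ⁆ ≟ˢ ⁅ u ⁆
  ...     | yes _ = ℚP.≤-reflexive (sym (ℚP.+-identityʳ (f ⁅ u ⁆)))
  ...     | no u≢u = ⊥-elim (u≢u refl)

∈⇒1≤∣∣ : {n : ℕ} {X : Subset n} {u : Fin n} → u ∈ X → 1 ℕ.≤ ∣ X ∣
∈⇒1≤∣∣ {X = X} {u} u∈X = subst (ℕ._≤ ∣ X ∣) (∣⁅x⁆∣≡1 u)
  (p⊆q⇒∣p∣≤∣q∣ (λ v∈⁅u⁆ → subst (_∈ X) (sym (x∈⁅y⁆⇒x≡y u v∈⁅u⁆)) u∈X))

∣∣≡0⇒≡⊥ : {n : ℕ} (X : Subset n) → ∣ X ∣ ≡ 0 → X ≡ ∅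
∣∣≡0⇒≡⊥ X ∣X∣≡0 = Empty-unique (λ (u , u∈X) → ℕP.<⇒≢ (∈⇒1≤∣∣ u∈X) (sym ∣X∣≡0))

big-or-singleton : {n : ℕ} {X : Subset n} {u : Fin n} → u ∈ X → 2 ℕ.≤ ∣ X ∣ ⊎ X ≡ ⁅ u ⁆
big-or-singleton {X = X} {u} u∈X with 2 ℕ.≤? ∣ X ∣
... | yes 2≤∣X∣ = inj₁ 2≤∣X∣
... | no  2≰∣X∣ = inj₂ (small X u u∈X (ℕP.≰⇒> 2≰∣X∣))
  where
  small : ∀ {n} (X : Subset n) u → u ∈ X → ∣ X ∣ ℕ.< 2 → X ≡ ⁅ u ⁆
  small (true ∷ X)  F.zero    here        (s≤s (s≤s ∣X∣≤0)) =
    cong (true ∷_) (∣∣≡0⇒≡⊥ X (ℕP.n≤0⇒n≡0 ∣X∣≤0))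
  small (true ∷ X)  (F.suc u) (there u∈X) (s≤s (s≤s ∣X∣≤0)) =
    ⊥-elim (ℕP.<⇒≱ (s≤s z≤n) (ℕP.≤-trans (∈⇒1≤∣∣ u∈X) ∣X∣≤0))
  small (false ∷ X) (F.suc u) (there u∈X) ∣X∣<2 = cong (false ∷_) (small X u u∈X ∣X∣<2)

nonneg-on-nonempty : {n : ℕ} (U : Subset n) (f : Subset n → ℚ) →
  (∀ X → X ⊆ U × 2 ℕ.≤ ∣ X ∣ → 0ℚ ≤ f X) → (∀ u → u ∈ U → 0ℚ ≤ f ⁅ u ⁆) →
  ∀ X → Nonempty X × X ⊆ U → 0ℚ ≤ f X
nonneg-on-nonempty U f big≥0 single≥0 X ((u , u∈X) , X⊆U) with big-or-singleton u∈X
... | inj₁ 2≤∣X∣ = big≥0 X (X⊆U , 2≤∣X∣)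
... | inj₂ refl  = single≥0 u (X⊆U u∈X)

count-witness : {X : Set} (xs : List X) (P : X → Bool) →
  1 ℕ.≤ Σℕ xs (λ x → if P x then 1 else 0) → ∃ λ x → P x ≡ true
count-witness []       P ()
count-witness (x ∷ xs) P 1≤count with P x in Px
... | true  = x , Px
... | false = count-witness xs P 1≤count

0<m-n⇒1≤m : (c₁ c₂ : ℕ) → + 0 ℤ.< + c₁ ℤ.- + c₂ → 1 ℕ.≤ c₁
0<m-n⇒1≤m zero    zero     (+<+ ())
0<m-n⇒1≤m zero    (suc c₂) ()
0<m-n⇒1≤m (suc c₁) c₂      _ = s≤s z≤n

0<-[m-n]⇒1≤n : (c₁ c₂ : ℕ) → + 0 ℤ.< ℤ.- (+ c₁ ℤ.- + c₂) → 1 ℕ.≤ c₂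
0<-[m-n]⇒1≤n zero     zero     (+<+ ())
0<-[m-n]⇒1≤n (suc c₁) zero     ()
0<-[m-n]⇒1≤n c₁       (suc c₂) _ = s≤s z≤n

reduced-cost⇒bound : (W P Q : ℤ) → + 0 ℤ.≤ W ℤ.+ P ℤ.- Q → ℤ.- P ℤ.+ Q ℤ.≤ W
reduced-cost⇒bound W P Q 0≤rc = ℤP.0≤i-j⇒j≤i (subst (+ 0 ℤ.≤_) (sym (rearrange W P Q)) 0≤rc)
  where
  open +-*-Solver
  rearrange : ∀ W P Q → W ℤ.- (ℤ.- P ℤ.+ Q) ≡ W ℤ.+ P ℤ.- Q
  rearrange = solve 3 (λ W P Q → W :- (:- P :+ Q) := W :+ P :- Q) refl

module _ {V A : Set} (t h : A → V) (B : A → Bool) where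

  _++ʷ_ : ∀ {x y z} → Walk⁺ t h B x y → Walk⁺ t h B y z → Walk⁺ t h B x z
  one a Ba      ++ʷ W′ = cons a Ba W′
  cons a Ba W   ++ʷ W′ = cons a Ba (W ++ʷ W′)

  -- Pigeonhole: if every vertex of a nonempty set X ⊆ Fin k (placed in V by e)
  -- is entered by an arc of B whose tail lies again in X, then following these
  -- arcs backwards revisits a vertex, so B contains a closed walk.
  closed-walk : {k : ℕ} (e : Fin k → V) (X : Fin k → Set) →
    (∀ u → X u → Σ A λ a → B a ≡ true × h a ≡ e u × Σ (Fin k) λ v → t a ≡ e v × X v) →
    ∃ X → ∃ λ z → Walk⁺ t h B z z
  closed-walk {k} e X pred (u₀ , u₀∈X) =
    close-at-repeat (FinP.pigeonhole (ℕP.n<1+n k) (λ (i : Fin (suc k)) → vertex (toℕ i)))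
    where
    trace : ℕ → Σ (Fin k) X
    trace zero    = u₀ , u₀∈X
    trace (suc i) = let (_ , _ , _ , v , _ , v∈X) = pred (proj₁ (trace i)) (proj₂ (trace i)) in v , v∈X

    vertex : ℕ → Fin k
    vertex i = proj₁ (trace i)

    step : ∀ i → Walk⁺ t h B (e (vertex (suc i))) (e (vertex i))
    step i with pred (proj₁ (trace i)) (proj₂ (trace i))
    ... | a , Ba , ha , v , ta , _ = subst₂ (Walk⁺ t h B) ta ha (one a Ba)

    walk-back : ∀ i d → Walk⁺ t h B (e (vertex (suc d ℕ.+ i))) (e (vertex i))
    walk-back i zero    = step i
    walk-back i (suc d) = step (suc d ℕ.+ i) ++ʷ walk-back i d

    -- a repetition vertex(i) = vertex(j), i < j, closes the walk from vertex(j) back to vertex(i)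
    close-at-repeat : (∃₂ λ (i j : Fin (suc k)) → i F.< j × vertex (toℕ i) ≡ vertex (toℕ j)) →
      ∃ λ z → Walk⁺ t h B z z
    close-at-repeat (i , j , i<j , vᵢ≡vⱼ) =
      e (vertex (toℕ i)) ,
      subst (λ z → Walk⁺ t h B z (e (vertex (toℕ i))))
            (cong e (trans (cong vertex gap) (sym vᵢ≡vⱼ)))
            (walk-back (toℕ i) (toℕ j ℕ.∸ suc (toℕ i)))
      where
      gap : suc (toℕ j ℕ.∸ suc (toℕ i)) ℕ.+ toℕ i ≡ toℕ j
      gap = trans (sym (ℕP.+-suc (toℕ j ℕ.∸ suc (toℕ i)) (toℕ i))) (ℕP.m∸n+n≡m i<j)

module Feasibility (n m : ℕ) (tl hd : Fin m → Fin n) (inS : Fin n → Bool) (w : Fin m → ℕ) where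
  open Setup n m tl hd inS w

  ∈Sset⇒ : ∀ {u} → u ∈ Sset → InS u
  ∈Sset⇒ {u} u∈S = trans (sym (VecP.lookup∘tabulate inS u)) (VecP.[]=⇒lookup u∈S)

  ∈Tset⇒ : ∀ {v} → v ∈ Tset → InT v
  ∈Tset⇒ {v} v∈T = BoolP.not-injective
    (trans (sym (VecP.lookup∘tabulate (λ v → not (inS v)) v)) (VecP.[]=⇒lookup v∈T))

  S∩T≡∅ : ∀ {u} → InS u → ¬ InT u
  S∩T≡∅ inS inT with trans (sym inS) inT
  ... | ()

  AST⇒hd∈T : ∀ a → inAST a ≡ true → InT (hd a)
  AST⇒hd∈T a ast = BoolP.not-injective (BoolP.∧-conicalʳ (inS (tl a)) _ ast)

  flow-out : (ξ : Fin m → Bool) (u : Fin n) → + 0 ℤ.< ∂ ξ u →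
    ∃ λ a → ξ a ∧ inAST a ≡ true × tl a ≡ u
  flow-out ξ u ∂ξu>0 = a , proj₁ flow∧tl≡u , does-true⇒ (tl a FinP.≟ u) (proj₂ flow∧tl≡u)
    where
    out-of-u into-u : Fin m → Bool
    out-of-u a = ξ a ∧ inAST a ∧ does (tl a FinP.≟ u)
    into-u   a = ξ a ∧ inAST a ∧ does (hd a FinP.≟ u)
    witness = count-witness arcs out-of-u (0<m-n⇒1≤m (count out-of-u) (count into-u) ∂ξu>0)
    a = proj₁ witness
    flow∧tl≡u = ∧₃-split (ξ a) (inAST a) _ (proj₂ witness)

  flow-in : (ξ : Fin m → Bool) (v : Fin n) → + 0 ℤ.< neg∂ ξ v →
    ∃ λ a → ξ a ∧ inAST a ≡ true × hd a ≡ v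
  flow-in ξ v -∂ξv>0 = a , proj₁ flow∧hd≡v , does-true⇒ (hd a FinP.≟ v) (proj₂ flow∧hd≡v)
    where
    out-of-v into-v : Fin m → Bool
    out-of-v a = ξ a ∧ inAST a ∧ does (tl a FinP.≟ v)
    into-v   a = ξ a ∧ inAST a ∧ does (hd a FinP.≟ v)
    witness = count-witness arcs into-v (0<-[m-n]⇒1≤n (count out-of-v) (count into-v) -∂ξv>0)
    a = proj₁ witness
    flow∧hd≡v = ∧₃-split (ξ a) (inAST a) _ (proj₂ witness)

  -- An arc u r_S of a reversed branching is the only arc of it leaving u, so u
  -- is left by no arc of B ∩ A[S]; dually an arc r_T v is the only one entering v.
  sink-arc⇒unleft : (B : ArcAux → Bool) → AtMostOneIn hdS tlS B → ∀ {u} → B (inj₁ u) ≡ true →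
    ¬ Entered hd tl (∩AS B) u
  sink-arc⇒unleft B one-out {u} Bu (a , Ba∩ , tla≡u)
    with one-out (inj₁ u) (inj₂ a) Bu (BoolP.∧-conicalˡ _ _ Ba∩) (cong just (sym tla≡u))
  ... | ()

  source-arc⇒unentered : (B : ArcAux → Bool) → AtMostOneIn tlT hdT B → ∀ {v} → B (inj₁ v) ≡ true →
    ¬ Entered tl hd (∩AT B) v
  source-arc⇒unentered B one-in {v} Bv (a , Ba∩ , hda≡v)
    with one-in (inj₁ v) (inj₂ a) Bv (BoolP.∧-conicalˡ _ _ Ba∩) (cong just (sym hda≡v))
  ... | ()

  module Primal (ξ : Fin m → Bool) (BS BT : ArcAux → Bool) where

    inX* : Fin m → Bool
    inX* a = (ξ a ∧ inAST a) ∨ ∩AS BS a ∨ ∩AT BT a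

    flow∈x* : ∀ {a} → ξ a ∧ inAST a ≡ true → inX* a ≡ true
    flow∈x* {a} flow = cong (_∨ (∩AS BS a ∨ ∩AT BT a)) flow

    BS∈x* : ∀ {a} → ∩AS BS a ≡ true → inX* a ≡ true
    BS∈x* {a} a∈BS = trans (cong (λ b → (ξ a ∧ inAST a) ∨ b ∨ ∩AT BT a) a∈BS) (BoolP.∨-zeroʳ _)

    BT∈x* : ∀ {a} → ∩AT BT a ≡ true → inX* a ≡ true
    BT∈x* {a} a∈BT = trans (cong (λ b → (ξ a ∧ inAST a) ∨ ∩AS BS a ∨ b) a∈BT)
      (trans (cong ((ξ a ∧ inAST a) ∨_) (BoolP.∨-zeroʳ (∩AS BS a))) (BoolP.∨-zeroʳ _))

    x*-nonneg : ∀ a → 0ℚ ≤ xstar ξ BS BT a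
    x*-nonneg a with inX* a
    ... | true  = ℤ→ℚ-mono-≤ {+ 0} {+ 1} (+≤+ z≤n)
    ... | false = ℚP.≤-refl

    x*-arc⇒≥1 : {C : Fin m → Set} (C? : Decidable C) →
      (∃ λ a → C a × inX* a ≡ true) → 1ℚ ≤ Σℚ[ arcs ∣ C? ] (xstar ξ BS BT)
    x*-arc⇒≥1 C? (a , Ca , a∈x*) =
      subst (_≤ Σℚ[ arcs ∣ C? ] (xstar ξ BS BT)) (cong (λ b → if b then 1ℚ else 0ℚ) a∈x*)
        (Σℚ[]-elem C? arcs (λ a _ → x*-nonneg a) (∈-allFin a) Ca)

    -- Every nonempty X ⊆ S is left by an arc of x*: otherwise each u ∈ X is left
    -- by an arc of B̃_S ending in X, and the reversal of B̃_S has a cycle.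
    cut-S : ∀ {p} → MinArbS p (∂ ξ) BS → ∀ X → NESub Sset X → ∃ λ a → Leaves a X × inX* a ≡ true
    cut-S ((B⊆AS , ((one-out , acyclic) , left)) , roots , _) X (nonempty , X⊆S)
      with FinP.any? (λ a → Leaves? a X ×-dec (inX* a BoolP.≟ true))
    ... | yes crossing = crossing
    ... | no  none     = ⊥-elim (acyclic _ (proj₂ (closed-walk hdS tlS BS just (_∈ X) stays-in-X nonempty)))
      where
      stays-in-X : ∀ u → u ∈ X →
        Σ ArcAux λ x → BS x ≡ true × tlS x ≡ just u × Σ (Fin n) λ v → hdS x ≡ just v × v ∈ X
      stays-in-X u u∈X with left (just u) (∈Sset⇒ (X⊆S u∈X)) (λ ())
      ... | inj₂ a , Ba , refl with hd a ∈? X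
      ...   | yes hd∈X = inj₂ a , Ba , refl , hd a , refl , hd∈X
      ...   | no  hd∉X = ⊥-elim (none (a , (u∈X , hd∉X) , BS∈x* (cong₂ _∧_ Ba (B⊆AS (inj₂ a) Ba))))
      stays-in-X u u∈X | inj₁ .u , Bu , refl
        with flow-out ξ u (Equivalence.to (roots u (∈Sset⇒ (X⊆S u∈X))) (sink-arc⇒unleft BS one-out Bu))
      ... | a , flow , refl = ⊥-elim (none (a , (u∈X , hd∉X) , flow∈x* flow))
        where
        hd∉X : ¬ hd a ∈ X
        hd∉X hd∈X = S∩T≡∅ (∈Sset⇒ (X⊆S hd∈X)) (AST⇒hd∈T a (BoolP.∧-conicalʳ (ξ a) _ flow))

    cut-T : ∀ {q} → MinArbT q (neg∂ ξ) BT → ∀ X → NESub Tset X → ∃ λ a → Enters a X × inX* a ≡ true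
    cut-T ((B⊆AT , ((one-in , acyclic) , entered)) , roots , _) X (nonempty , X⊆T)
      with FinP.any? (λ a → Enters? a X ×-dec (inX* a BoolP.≟ true))
    ... | yes crossing = crossing
    ... | no  none     = ⊥-elim (acyclic _ (proj₂ (closed-walk tlT hdT BT just (_∈ X) stays-in-X nonempty)))
      where
      stays-in-X : ∀ v → v ∈ X →
        Σ ArcAux λ x → BT x ≡ true × hdT x ≡ just v × Σ (Fin n) λ u → tlT x ≡ just u × u ∈ X
      stays-in-X v v∈X with entered (just v) (∈Tset⇒ (X⊆T v∈X)) (λ ())
      ... | inj₂ a , Ba , refl with tl a ∈? X
      ...   | yes tl∈X = inj₂ a , Ba , refl , tl a , refl , tl∈X
      ...   | no  tl∉X = ⊥-elim (none (a , (v∈X , tl∉X) , BT∈x* (cong₂ _∧_ Ba (B⊆AT (inj₂ a) Ba))))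
      stays-in-X v v∈X | inj₁ .v , Bv , refl
        with flow-in ξ v (Equivalence.to (roots v (∈Tset⇒ (X⊆T v∈X))) (source-arc⇒unentered BT one-in Bv))
      ... | a , flow , refl = ⊥-elim (none (a , (v∈X , tl∉X) , flow∈x* flow))
        where
        tl∉X : ¬ tl a ∈ X
        tl∉X tl∈X = S∩T≡∅ (BoolP.∧-conicalˡ _ _ (BoolP.∧-conicalʳ (ξ a) _ flow)) (∈Tset⇒ (X⊆T tl∈X))

    primal-feasible : ∀ {p q} → MinArbS p (∂ ξ) BS → MinArbT q (neg∂ ξ) BT → FeasP (xstar ξ BS BT)
    primal-feasible minS minT =
      (λ X X≢∅ → x*-arc⇒≥1 (λ a → Leaves? a X) (cut-S minS X X≢∅)) ,
      (λ X X≢∅ → x*-arc⇒≥1 (λ a → Enters? a X) (cut-T minT X X≢∅)) ,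
      x*-nonneg

  reduced-cost-nonneg : ∀ {ξ p q} → CondI ξ p q → Tight ξ p q →
    ∀ a → inAST a ≡ true → + 0 ℤ.≤ + w a ℤ.+ p (tl a) ℤ.- q (hd a)
  reduced-cost-nonneg {ξ} condI tight a ast with ξ a in ξa
  ... | true  = ℤP.≤-reflexive (sym (tight a ast ξa))
  ... | false = proj₂ (condI a ast) ξa

  module Dual {p q : Fin n → ℤ} {π ρ : Subset n → ℚ}
    (feasπ : FeasD'' p π) (π₁≥0 : ∀ u → InS u → 0ℚ ≤ π ⁅ u ⁆)
    (feasρ : FeasD' q ρ) (ρ₁≥0 : ∀ v → InT v → 0ℚ ≤ ρ ⁅ v ⁆) where

    yLoad zLoad : Fin m → ℚ
    yLoad a = Σℚ[ subsets ∣ (λ X → NESub? Sset X ×-dec Leaves? a X) ] π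
    zLoad a = Σℚ[ subsets ∣ (λ X → NESub? Tset X ×-dec Enters? a X) ] ρ

    -- The y-load of an arc a with tail in S is at most w''(x) for any arc x of
    -- D_S with the same tail that leaves every set a leaves: the singleton
    -- {tail a} accounts for π(tail a) and all larger sets are left by x.
    yLoad≤ : ∀ a → InS (tl a) → (x : ArcAux) → ArcS x → tailS x ≡ tl a →
      (∀ X → tl a ∈ X → ¬ hd a ∈ X → LeavesS x X) → yLoad a ≤ ℤ→ℚ (w'' p x)
    yLoad≤ a tl∈S x arc-x tail≡tl leaves =
      ℚP.≤-trans (Σ-split-singleton π (tl a) (λ X → NESub? Sset X ×-dec Leaves? a X)
                   (λ X → BigS? X ×-dec LeavesS? x X) (π₁≥0 (tl a) tl∈S) (λ X big → proj₂ feasπ X (proj₁ big)) sort)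
                 (subst (λ u → π ⁅ u ⁆ + Σℚ[ subsets ∣ (λ X → BigS? X ×-dec LeavesS? x X) ] π ≤ ℤ→ℚ (w'' p x))
                        tail≡tl (proj₁ feasπ x arc-x))
      where
      sort : ∀ X → NESub Sset X × Leaves a X → (BigS X × LeavesS x X) ⊎ X ≡ ⁅ tl a ⁆
      sort X ((_ , X⊆S) , tl∈X , hd∉X) with big-or-singleton tl∈X
      ... | inj₁ 2≤∣X∣ = inj₁ ((X⊆S , 2≤∣X∣) , leaves X tl∈X hd∉X)
      ... | inj₂ X≡tl  = inj₂ X≡tl

    zLoad≤ : ∀ a → InT (hd a) → (x : ArcAux) → ArcT x → headT x ≡ hd a →
      (∀ X → hd a ∈ X → ¬ tl a ∈ X → EntersT x X) → zLoad a ≤ ℤ→ℚ (w' q x)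
    zLoad≤ a hd∈T x arc-x head≡hd enters =
      ℚP.≤-trans (Σ-split-singleton ρ (hd a) (λ X → NESub? Tset X ×-dec Enters? a X)
                   (λ X → BigT? X ×-dec EntersT? x X) (ρ₁≥0 (hd a) hd∈T) (λ X big → proj₂ feasρ X (proj₁ big)) sort)
                 (subst (λ v → ρ ⁅ v ⁆ + Σℚ[ subsets ∣ (λ X → BigT? X ×-dec EntersT? x X) ] ρ ≤ ℤ→ℚ (w' q x))
                        head≡hd (proj₁ feasρ x arc-x))
      where
      sort : ∀ X → NESub Tset X × Enters a X → (BigT X × EntersT x X) ⊎ X ≡ ⁅ hd a ⁆
      sort X ((_ , X⊆T) , hd∈X , tl∉X) with big-or-singleton hd∈X
      ... | inj₁ 2≤∣X∣ = inj₁ ((X⊆T , 2≤∣X∣) , enters X hd∈X tl∉X)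
      ... | inj₂ X≡hd  = inj₂ X≡hd

    yLoad-vanish : ∀ a → InT (tl a) → yLoad a ≡ 0ℚ
    yLoad-vanish a tl∈T = Σℚ[]-empty (λ X → NESub? Sset X ×-dec Leaves? a X) subsets π
      (λ X ((_ , X⊆S) , tl∈X , _) → S∩T≡∅ (∈Sset⇒ (X⊆S tl∈X)) tl∈T)

    zLoad-vanish : ∀ a → InS (hd a) → zLoad a ≡ 0ℚ
    zLoad-vanish a hd∈S = Σℚ[]-empty (λ X → NESub? Tset X ×-dec Enters? a X) subsets ρ
      (λ X ((_ , X⊆T) , hd∈X , _) → S∩T≡∅ hd∈S (∈Tset⇒ (X⊆T hd∈X)))

    arc-constraint : ∀ {ξ} → CondI ξ p q → Tight ξ p q → ∀ a → yLoad a + zLoad a ≤ ℤ→ℚ (+ w a)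
    arc-constraint {ξ} condI tight a with inS (tl a) in tl∈? | inS (hd a) in hd∈?
    ... | true | true = begin
      yLoad a + zLoad a   ≡⟨ cong (_+_ (yLoad a)) (zLoad-vanish a hd∈?) ⟩
      yLoad a + 0ℚ        ≡⟨ ℚP.+-identityʳ (yLoad a) ⟩
      yLoad a             ≤⟨ yLoad≤ a tl∈? (inj₂ a) (cong₂ _∧_ tl∈? hd∈?) refl (λ X tl∈X hd∉X → tl∈X , hd∉X) ⟩
      ℤ→ℚ (+ w a)         ∎
      where open ℚP.≤-Reasoning
    ... | false | false = begin
      yLoad a + zLoad a   ≡⟨ cong (_+ zLoad a) (yLoad-vanish a tl∈?) ⟩
      0ℚ + zLoad a        ≡⟨ ℚP.+-identityˡ (zLoad a) ⟩
      zLoad a             ≤⟨ zLoad≤ a hd∈? (inj₂ a) (cong₂ _∧_ (cong not tl∈?) (cong not hd∈?)) refl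
                                    (λ X hd∈X tl∉X → hd∈X , tl∉X) ⟩
      ℤ→ℚ (+ w a)         ∎
      where open ℚP.≤-Reasoning
    ... | false | true = begin
      yLoad a + zLoad a   ≡⟨ cong₂ _+_ (yLoad-vanish a tl∈?) (zLoad-vanish a hd∈?) ⟩
      ℤ→ℚ (+ 0)           ≤⟨ ℤ→ℚ-mono-≤ {+ 0} {+ w a} (+≤+ z≤n) ⟩
      ℤ→ℚ (+ w a)         ∎
      where open ℚP.≤-Reasoning
    ... | true | false = begin
      yLoad a + zLoad a                           ≤⟨ ℚP.+-mono-≤
          (yLoad≤ a tl∈? (inj₁ (tl a)) tl∈? refl (λ X tl∈X _ → tl∈X , λ ()))
          (zLoad≤ a hd∈? (inj₁ (hd a)) hd∈? refl (λ X hd∈X _ → hd∈X , λ ())) ⟩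
      ℤ→ℚ (ℤ.- p (tl a)) + ℤ→ℚ (q (hd a))         ≡⟨ ℤ→ℚ-+ (ℤ.- p (tl a)) (q (hd a)) ⟩
      ℤ→ℚ (ℤ.- p (tl a) ℤ.+ q (hd a))             ≤⟨ ℤ→ℚ-mono-≤ (reduced-cost⇒bound (+ w a) (p (tl a)) (q (hd a))
                                                        (reduced-cost-nonneg {ξ} {p} {q} condI tight a
                                                          (cong₂ _∧_ tl∈? (cong not hd∈?)))) ⟩
      ℤ→ℚ (+ w a)                                 ∎
      where open ℚP.≤-Reasoning

    dual-feasible : ∀ {ξ} → CondI ξ p q → Tight ξ p q → FeasD (ystar π) (zstar ρ)
    dual-feasible condI tight =
      arc-constraint condI tight ,
      nonneg-on-nonempty Sset π (proj₂ feasπ) (λ u u∈S → π₁≥0 u (∈Sset⇒ u∈S)) ,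
      nonneg-on-nonempty Tset ρ (proj₂ feasρ) (λ v v∈T → ρ₁≥0 v (∈Tset⇒ v∈T))

-- Only condition (i), tightness, the arborescence and root properties of B̃_S,
-- B̃_T, feasibility of π*, ρ* and nonnegativity of their singleton values are
-- needed.
lemma6 : (n m : ℕ) (tl hd : Fin m → Fin n) (inS : Fin n → Bool) (w : Fin m → ℕ) →
    let open Setup n m tl hd inS w in
    (∃ λ u → InS u) → (∃ λ v → InT v) →
    (∀ a → ¬ (InT (tl a) × InS (hd a))) →
    (ξ : Fin m → Bool) → OptimalFlow ξ →
    (p q : Fin n → ℤ) → CondI ξ p q → CondII ξ p → CondIII ξ q → Tight ξ p q →
    (BT : Fin n ⊎ Fin m → Bool) → MinArbT q (neg∂ ξ) BT →
    (ρ : Subset n → ℚ) → OptD' q ρ → IntegralT ρ → (∀ v → InT v → 0ℚ ≤ ρ ⁅ v ⁆) →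
    (BS : Fin n ⊎ Fin m → Bool) → MinArbS p (∂ ξ) BS →
    (π : Subset n → ℚ) → OptD'' p π → IntegralS π → (∀ u → InS u → 0ℚ ≤ π ⁅ u ⁆) →
    FeasP (xstar ξ BS BT) × FeasD (ystar π) (zstar ρ)
lemma6 n m tl hd inS w _ _ _ ξ _ p q condI _ _ tight BT minT ρ optD' _ ρ₁≥0 BS minS π optD'' _ π₁≥0 =
  primal-feasible minS minT , dual-feasible condI tight
  where
  open Feasibility n m tl hd inS w
  open Primal ξ BS BT
  open Dual (proj₁ optD'') π₁≥0 (proj₁ optD') ρ₁≥0
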